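{- Let $\tau=(a_1\;a_2\;\cdots\;a_k)\in S_n$ be a $k$-cycle with $k\ge 2$ on distinct points of $\{1,\dots,n\}$, and let $x,y$ be two new points, with $S_{n+2}$ the symmetric group on $\{1,\dots,n,x,y\}$. Then $$\tau^{ -1}=(x\;y)\,(x\;a_2)(x\;a_3)\cdots(x\;a_k)\,(y\;a_1)(y\;a_2)(x\;a_1),$$ which expresses $\tau^{ -1}$ as a product of distinct transpositions, each of which moves $x$ or $y$ (i.e. each lies in $S_{n+2}\setminus S_n$).
   Context: Products of permutations are compositions, the rightmost factor applied first. $S_n$ is viewed inside $S_{n+2}$ as the permutations fixing $x$ and $y$. -}

module Defs where

open import Data.Nat using (ℕ; suc)
open import Data.Fin using (Fin; zero; suc)
open import Data.Fin.Properties using (_≟_)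
open import Data.List using (List; []; _∷_; _++_; map; foldr)
open import Data.Product using (_×_; _,_)
open import Relation.Nullary using (yes; no)
open import Function using (_∘_; id)

-- A permutation is represented by its underlying function.
-- The transposition (p q) on Fin m.
swap : ∀ {m} → Fin m → Fin m → Fin m → Fin m
swap p q z with z ≟ p
... | yes _ = q
... | no _ with z ≟ q
...   | yes _ = p
...   | no _ = z

cycleGo : ∀ {m} → Fin m → Fin m → List (Fin m) → Fin m → Fin m
cycleGo h a [] z with z ≟ a
... | yes _ = h
... | no _ = z
cycleGo h a (b ∷ r) z with z ≟ a
... | yes _ = b
... | no _ = cycleGo h b r z

-- The cycle (a₁ a₂ ⋯ a_k) given by the list [a₁, …, a_k] (entries assumed distinct).
cycle : ∀ {m} → List (Fin m) → Fin m → Fin m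
cycle [] = id
cycle (a ∷ r) = cycleGo a a r

X : ∀ {n} → Fin (suc (suc n))
X = zero

Y : ∀ {n} → Fin (suc (suc n))
Y = suc zero

old : ∀ {n} → Fin n → Fin (suc (suc n))
old i = suc (suc i)

embed : ∀ {n} → (Fin n → Fin n) → Fin (suc (suc n)) → Fin (suc (suc n))
embed f zero = zero
embed f (suc zero) = suc zero
embed f (suc (suc i)) = suc (suc (f i))

-- Product of a list of transpositions, rightmost factor applied first:
-- prodSwaps [t₁, …, t_r] = t₁ ∘ ⋯ ∘ t_r.
prodSwaps : ∀ {m} → List (Fin m × Fin m) → Fin m → Fin m
prodSwaps = foldr (λ { (p , q) g → swap p q ∘ g }) id

-- Transpositions are equal iff they have the same unordered support {p,q}.
SameTransposition : ∀ {m} → Fin m × Fin m → Fin m × Fin m → Set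
SameTransposition (p , q) (p' , q') = (p ≡ p' × q ≡ q') ⊎ (p ≡ q' × q ≡ p')
  where
  open import Relation.Binary.PropositionalEquality using (_≡_)
  open import Data.Sum using (_⊎_)

-- The factor list of the theorem for τ = (a₁ a₂ a₃ ⋯ a_k), given as a₁, a₂, rest = [a₃,…,a_k]:
-- (x y)(x a₂)(x a₃)⋯(x a_k)(y a₁)(y a₂)(x a₁).
factors : ∀ {n} → Fin n → Fin n → List (Fin n) → List (Fin (suc (suc n)) × Fin (suc (suc n)))
factors a₁ a₂ rest =
  (X , Y) ∷ ((X , old a₂) ∷ map (λ a → (X , old a)) rest)
  ++ ((Y , old a₁) ∷ (Y , old a₂) ∷ (X , old a₁) ∷ [])

-- The star product σ = (x a₂)(x a₃)⋯(x a_k) is the inverse of the cycle (x a₂ ⋯ a_k), and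
-- ρ = (y a₁)(y a₂)(x a₁) is the 4-cycle (x y a₂ a₁).  Chasing a point through (x y) σ ρ:
-- x ↦ y ↦ y ↦ x and y ↦ a₂ ↦ x ↦ y are fixed, a₂ ↦ a₁ ↦ a₁ ↦ a₁, a₁ ↦ x ↦ a_k ↦ a_k, and
-- a_{i+1} ↦ a_{i+1} ↦ a_i ↦ a_i for i ≥ 2; this is τ⁻¹.  Cycles and star products are both
-- described by the consecutive pairs (Adjacent) of the closed walk a ∷ r ∷ʳ a, so one case
-- split on such a pair gives π ∘ τ = id and τ ∘ π = id alike.
module Submission where

open import Level using (Level)
open import Defs
open import Data.Nat using (ℕ; suc)
open import Data.Fin using (Fin; zero; suc)
open import Data.Fin.Properties using (_≟_)
open import Data.List using (List; []; _∷_; _++_; _∷ʳ_; map)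
open import Data.List.Properties using (map-∘)
open import Data.List.Membership.Propositional using (_∈_; _∉_)
open import Data.List.Membership.Propositional.Properties using (∈-++⁺ˡ; ∈-++⁺ʳ)
open import Data.List.Relation.Unary.Any using (here; there; any?)
open import Data.List.Relation.Unary.All as All using (All; []; _∷_)
import Data.List.Relation.Unary.All.Properties as Allₚ
open import Data.List.Relation.Unary.AllPairs as AllPairs using (AllPairs; []; _∷_)
import Data.List.Relation.Unary.AllPairs.Properties as AllPairsₚ
open import Data.List.Relation.Unary.Unique.Propositional using (Unique)
open import Data.List.Relation.Unary.Unique.Propositional.Properties
  using (Unique[x∷xs]⇒x∉xs) renaming (map⁺ to Unique-map⁺)
open import Data.Product using (_×_; _,_; proj₁; proj₂; ∃; map₂)
open import Data.Sum using (_⊎_; inj₁; inj₂) renaming (map to ⊎-map)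
open import Function using (_∘_)
open import Relation.Nullary using (¬_; yes; no; contradiction)
open import Relation.Binary.PropositionalEquality

private
  variable
    ℓ : Level
    A : Set ℓ
    m n : ℕ

swap-fst : (p q : Fin m) → swap p q p ≡ q
swap-fst p q with p ≟ p
... | yes _ = refl
... | no p≢p = contradiction refl p≢p

swap-snd : (p q : Fin m) → swap p q q ≡ p
swap-snd p q with q ≟ p
... | yes refl = refl
... | no _ with q ≟ q
...   | yes _ = refl
...   | no q≢q = contradiction refl q≢q

swap-fixes : {p q z : Fin m} → z ≢ p → z ≢ q → swap p q z ≡ z
swap-fixes {p = p} {q} {z} z≢p z≢q with z ≟ p
... | yes z≡p = contradiction z≡p z≢p
... | no _ with z ≟ q
...   | yes z≡q = contradiction z≡q z≢q
...   | no _ = refl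

prodSwaps-++ : (ts us : List (Fin m × Fin m)) (z : Fin m) →
               prodSwaps (ts ++ us) z ≡ prodSwaps ts (prodSwaps us z)
prodSwaps-++ []             us z = refl
prodSwaps-++ ((p , q) ∷ ts) us z = cong (swap p q) (prodSwaps-++ ts us z)

¬same-fst : {p q q′ : Fin m} → q ≢ q′ → ¬ SameTransposition (p , q) (p , q′)
¬same-fst q≢q′ (inj₁ (_ , q≡q′))    = q≢q′ q≡q′
¬same-fst q≢q′ (inj₂ (p≡q′ , q≡p)) = q≢q′ (trans q≡p p≡q′)

¬same-≢fst : {p q p′ q′ : Fin m} → p ≢ p′ → p ≢ q′ → ¬ SameTransposition (p , q) (p′ , q′)
¬same-≢fst p≢p′ _ (inj₁ (p≡p′ , _)) = p≢p′ p≡p′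
¬same-≢fst _ p≢q′ (inj₂ (p≡q′ , _)) = p≢q′ p≡q′

data Adjacent {A : Set ℓ} : List A → A → A → Set ℓ where
  here  : ∀ {b c l} → Adjacent (b ∷ c ∷ l) b c
  there : ∀ {d b c l} → Adjacent l b c → Adjacent (d ∷ l) b c

adjacent-fst∈ : ∀ {b c : A} {l} → Adjacent l b c → b ∈ l
adjacent-fst∈ here      = here refl
adjacent-fst∈ (there p) = there (adjacent-fst∈ p)

adjacent-++⁺ : ∀ {b c : A} {l l′} → Adjacent l b c → Adjacent (l ++ l′) b c
adjacent-++⁺ here      = here
adjacent-++⁺ (there p) = there (adjacent-++⁺ p)

adjacent-snd∈ : ∀ {d b c : A} {l} → Adjacent (d ∷ l) b c → c ∈ l
adjacent-snd∈             here      = here refl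
adjacent-snd∈ {l = _ ∷ _} (there p) = there (adjacent-snd∈ p)

adjacent-∷⁻ : ∀ {d b c e : A} {l} → Adjacent (d ∷ l) b c →
              (b ≡ d × Adjacent (e ∷ l) e c) ⊎ Adjacent l b c
adjacent-∷⁻ here      = inj₁ (refl , here)
adjacent-∷⁻ (there p) = inj₂ p

adjacent-∷ʳ-fst∈ : ∀ {h b c : A} l → Adjacent (l ∷ʳ h) b c → b ∈ l
adjacent-∷ʳ-fst∈ []          (there ())
adjacent-∷ʳ-fst∈ (_ ∷ [])    here      = here refl
adjacent-∷ʳ-fst∈ (_ ∷ _ ∷ _) here      = here refl
adjacent-∷ʳ-fst∈ (_ ∷ l)     (there p) = there (adjacent-∷ʳ-fst∈ l p)

adjacent-∷ʳ⁻ : ∀ {h b c : A} h′ l → Adjacent (l ∷ʳ h) b c →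
               Adjacent l b c ⊎ (c ≡ h × Adjacent (l ∷ʳ h′) b h′)
adjacent-∷ʳ⁻ h′ []              (there ())
adjacent-∷ʳ⁻ h′ (_ ∷ [])        here               = inj₂ (refl , here)
adjacent-∷ʳ⁻ h′ (_ ∷ [])        (there (there ()))
adjacent-∷ʳ⁻ h′ (_ ∷ _ ∷ _)     here               = inj₁ here
adjacent-∷ʳ⁻ h′ (_ ∷ l@(_ ∷ _)) (there p)          = ⊎-map there (map₂ there) (adjacent-∷ʳ⁻ h′ l p)

∈⇒adjacent-succ : ∀ {b h : A} l → b ∈ l → ∃ λ c → Adjacent (l ∷ʳ h) b c
∈⇒adjacent-succ (_ ∷ [])    (here refl) = _ , here
∈⇒adjacent-succ (_ ∷ _ ∷ _) (here refl) = _ , here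
∈⇒adjacent-succ (_ ∷ l)     (there b∈)  = map₂ there (∈⇒adjacent-succ l b∈)

∈⇒adjacent-pred : ∀ {c d : A} {l} → c ∈ l → ∃ λ b → Adjacent (d ∷ l) b c
∈⇒adjacent-pred (here refl) = _ , here
∈⇒adjacent-pred (there c∈)  = map₂ there (∈⇒adjacent-pred c∈)

∉⇒≢ : ∀ {b c : A} {l} → c ∉ l → b ∈ l → b ≢ c
∉⇒≢ c∉ b∈ refl = c∉ b∈

∈-∷⇒∈-∷ʳ : ∀ {c a : A} {l} → c ∈ a ∷ l → c ∈ l ∷ʳ a
∈-∷⇒∈-∷ʳ {l = l} (here refl) = ∈-++⁺ʳ l (here refl)
∈-∷⇒∈-∷ʳ         (there c∈)  = ∈-++⁺ˡ c∈

cycleGo-fixes : ∀ (h a : Fin m) r {z} → z ∉ a ∷ r → cycleGo h a r z ≡ z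
cycleGo-fixes h a []      {z} z∉ with z ≟ a
... | yes z≡a = contradiction (here z≡a) z∉
... | no _    = refl
cycleGo-fixes h a (b ∷ r) {z} z∉ with z ≟ a
... | yes z≡a = contradiction (here z≡a) z∉
... | no _    = cycleGo-fixes h b r (z∉ ∘ there)

cycleGo-adjacent : ∀ (h a : Fin m) r {b c} → Unique (a ∷ r) →
                   Adjacent (a ∷ r ∷ʳ h) b c → cycleGo h a r b ≡ c
cycleGo-adjacent h a []      u here with a ≟ a
... | yes _   = refl
... | no a≢a = contradiction refl a≢a
cycleGo-adjacent h a []      u (there (there ()))
cycleGo-adjacent h a (_ ∷ _) u here with a ≟ a
... | yes _   = refl
... | no a≢a = contradiction refl a≢a
cycleGo-adjacent h a (d ∷ r) {b} u (there p) with b ≟ a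
... | yes refl = contradiction (adjacent-∷ʳ-fst∈ (d ∷ r) p) (Unique[x∷xs]⇒x∉xs u)
... | no _     = cycleGo-adjacent h d r (AllPairs.tail u) p

cycle-∈-succ : ∀ {a b : A} r → b ∈ a ∷ r → ∃ λ c → Adjacent (a ∷ r ∷ʳ a) b c
cycle-∈-succ r = ∈⇒adjacent-succ (_ ∷ r)

cycle-∈-pred : ∀ {a c : A} {r} → c ∈ a ∷ r → ∃ λ b → Adjacent (a ∷ r ∷ʳ a) b c
cycle-∈-pred = ∈⇒adjacent-pred ∘ ∈-∷⇒∈-∷ʳ

star : Fin m → List (Fin m) → Fin m → Fin m
star h bs = prodSwaps (map (h ,_) bs)

star-fixes : ∀ {h z : Fin m} bs → z ≢ h → z ∉ bs → star h bs z ≡ z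
star-fixes []       z≢h z∉ = refl
star-fixes (d ∷ bs) z≢h z∉ =
  trans (cong (swap _ d) (star-fixes bs z≢h (z∉ ∘ there))) (swap-fixes z≢h (z∉ ∘ here))

star-adjacent : ∀ {h b c : Fin m} bs → Unique (h ∷ bs) →
                Adjacent (h ∷ bs ∷ʳ h) b c → star h bs c ≡ b
star-adjacent []       u here = refl
star-adjacent []       u (there (there ()))
star-adjacent {h = h} (d ∷ bs) ((h≢d ∷ _) ∷ u) here = begin
  swap h d (star h bs d)  ≡⟨ cong (swap h d) (star-fixes bs (≢-sym h≢d) (Unique[x∷xs]⇒x∉xs u)) ⟩
  swap h d d              ≡⟨ swap-snd h d ⟩
  h                       ∎
  where open ≡-Reasoning
star-adjacent {h = h} {b} {c} (d ∷ bs) ((_ ∷ h∉) ∷ u) (there p)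
  with adjacent-∷⁻ {e = h} p
... | inj₁ (refl , q) = begin
  swap h d (star h bs c)  ≡⟨ cong (swap h d) (star-adjacent bs (h∉ ∷ AllPairs.tail u) q) ⟩
  swap h d h              ≡⟨ swap-fst h d ⟩
  d                       ∎
  where open ≡-Reasoning
... | inj₂ q = begin
  swap h d (star h bs c)  ≡⟨ cong (swap h d) (star-adjacent bs (h∉ ∷ AllPairs.tail u) (there q)) ⟩
  swap h d b              ≡⟨ swap-fixes (∉⇒≢ (Allₚ.All¬⇒¬Any h∉) b∈) (∉⇒≢ (Unique[x∷xs]⇒x∉xs u) b∈) ⟩
  b                       ∎
  where
  open ≡-Reasoning
  b∈ : b ∈ bs
  b∈ = adjacent-∷ʳ-fst∈ bs q

inverseFactors : Fin m → Fin m → Fin m → Fin m → List (Fin m) → List (Fin m × Fin m)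
inverseFactors x y a₁ a₂ rest =
  (x , y) ∷ map (x ,_) (a₂ ∷ rest) ++ (y , a₁) ∷ (y , a₂) ∷ (x , a₁) ∷ []

module InverseFactors {x y a₁ a₂ : Fin m} {rest : List (Fin m)}
                      (u : Unique (x ∷ y ∷ a₁ ∷ a₂ ∷ rest)) where

  private
    bs : List (Fin m)
    bs = a₂ ∷ rest

    x≢ : All (x ≢_) (y ∷ a₁ ∷ bs)
    x≢ = AllPairs.head u

    y≢ : All (y ≢_) (a₁ ∷ bs)
    y≢ = AllPairs.head (AllPairs.tail u)

    unique-a₁bs : Unique (a₁ ∷ bs)
    unique-a₁bs = AllPairs.tail (AllPairs.tail u)

    unique-xbs : Unique (x ∷ bs)
    unique-xbs = All.tail (All.tail x≢) ∷ AllPairs.tail unique-a₁bs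

    x≢y : x ≢ y
    x≢y = All.head x≢

    x≢a₁ : x ≢ a₁
    x≢a₁ = All.head (All.tail x≢)

    x≢a₂ : x ≢ a₂
    x≢a₂ = All.head (All.tail (All.tail x≢))

    y≢a₁ : y ≢ a₁
    y≢a₁ = All.head y≢

    y≢a₂ : y ≢ a₂
    y≢a₂ = All.head (All.tail y≢)

    a₁≢a₂ : a₁ ≢ a₂
    a₁≢a₂ = All.head (AllPairs.head unique-a₁bs)

    x∉bs : x ∉ bs
    x∉bs = Unique[x∷xs]⇒x∉xs unique-xbs

    y∉bs : y ∉ bs
    y∉bs = Allₚ.All¬⇒¬Any (All.tail y≢)

    a₁∉bs : a₁ ∉ bs
    a₁∉bs = Unique[x∷xs]⇒x∉xs unique-a₁bs

    a₂∉rest : a₂ ∉ rest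
    a₂∉rest = Unique[x∷xs]⇒x∉xs (AllPairs.tail unique-a₁bs)

    swap-xy-fixes : ∀ {b} → b ∈ bs → swap x y b ≡ b
    swap-xy-fixes b∈ = swap-fixes (∉⇒≢ x∉bs b∈) (∉⇒≢ y∉bs b∈)

  π : Fin m → Fin m
  π = prodSwaps (inverseFactors x y a₁ a₂ rest)

  ρ : Fin m → Fin m
  ρ z = swap y a₁ (swap y a₂ (swap x a₁ z))

  σ : Fin m → Fin m
  σ = star x bs

  π-split : ∀ z → π z ≡ swap x y (σ (ρ z))
  π-split z = cong (swap x y) (prodSwaps-++ (map (x ,_) bs) _ z)

  ρ-x : ρ x ≡ y
  ρ-x = begin
    swap y a₁ (swap y a₂ (swap x a₁ x))  ≡⟨ cong (swap y a₁ ∘ swap y a₂) (swap-fst x a₁) ⟩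
    swap y a₁ (swap y a₂ a₁)             ≡⟨ cong (swap y a₁) (swap-fixes (≢-sym y≢a₁) a₁≢a₂) ⟩
    swap y a₁ a₁                         ≡⟨ swap-snd y a₁ ⟩
    y                                    ∎
    where open ≡-Reasoning

  ρ-y : ρ y ≡ a₂
  ρ-y = begin
    swap y a₁ (swap y a₂ (swap x a₁ y))  ≡⟨ cong (swap y a₁ ∘ swap y a₂) (swap-fixes (≢-sym x≢y) y≢a₁) ⟩
    swap y a₁ (swap y a₂ y)              ≡⟨ cong (swap y a₁) (swap-fst y a₂) ⟩
    swap y a₁ a₂                         ≡⟨ swap-fixes (≢-sym y≢a₂) (≢-sym a₁≢a₂) ⟩
    a₂                                   ∎
    where open ≡-Reasoning

  ρ-a₂ : ρ a₂ ≡ a₁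
  ρ-a₂ = begin
    swap y a₁ (swap y a₂ (swap x a₁ a₂))  ≡⟨ cong (swap y a₁ ∘ swap y a₂) (swap-fixes (≢-sym x≢a₂) (≢-sym a₁≢a₂)) ⟩
    swap y a₁ (swap y a₂ a₂)              ≡⟨ cong (swap y a₁) (swap-snd y a₂) ⟩
    swap y a₁ y                           ≡⟨ swap-fst y a₁ ⟩
    a₁                                    ∎
    where open ≡-Reasoning

  ρ-a₁ : ρ a₁ ≡ x
  ρ-a₁ = begin
    swap y a₁ (swap y a₂ (swap x a₁ a₁))  ≡⟨ cong (swap y a₁ ∘ swap y a₂) (swap-snd x a₁) ⟩
    swap y a₁ (swap y a₂ x)               ≡⟨ cong (swap y a₁) (swap-fixes x≢y x≢a₂) ⟩
    swap y a₁ x                           ≡⟨ swap-fixes x≢y x≢a₁ ⟩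
    x                                     ∎
    where open ≡-Reasoning

  ρ-fixes : ∀ {z} → z ≢ x → z ≢ y → z ≢ a₁ → z ≢ a₂ → ρ z ≡ z
  ρ-fixes z≢x z≢y z≢a₁ z≢a₂ =
    trans (cong (swap y a₁ ∘ swap y a₂) (swap-fixes z≢x z≢a₁))
          (trans (cong (swap y a₁) (swap-fixes z≢y z≢a₂)) (swap-fixes z≢y z≢a₁))

  π-x : π x ≡ x
  π-x = begin
    π x                    ≡⟨ π-split x ⟩
    swap x y (σ (ρ x))     ≡⟨ cong (swap x y ∘ σ) ρ-x ⟩
    swap x y (σ y)         ≡⟨ cong (swap x y) (star-fixes bs (≢-sym x≢y) y∉bs) ⟩
    swap x y y             ≡⟨ swap-snd x y ⟩
    x                      ∎
    where open ≡-Reasoning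

  π-y : π y ≡ y
  π-y = begin
    π y                    ≡⟨ π-split y ⟩
    swap x y (σ (ρ y))     ≡⟨ cong (swap x y ∘ σ) ρ-y ⟩
    swap x y (σ a₂)        ≡⟨ cong (swap x y) (star-adjacent bs unique-xbs here) ⟩
    swap x y x             ≡⟨ swap-fst x y ⟩
    y                      ∎
    where open ≡-Reasoning

  π-fixes : ∀ {z} → z ∉ a₁ ∷ bs → π z ≡ z
  π-fixes {z} z∉ with z ≟ x | z ≟ y
  ... | yes refl | _        = π-x
  ... | no _     | yes refl = π-y
  ... | no z≢x   | no z≢y   = begin
    π z                    ≡⟨ π-split z ⟩
    swap x y (σ (ρ z))     ≡⟨ cong (swap x y ∘ σ) (ρ-fixes z≢x z≢y (z∉ ∘ here) (λ z≡a₂ → z∉ (there (here z≡a₂)))) ⟩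
    swap x y (σ z)         ≡⟨ cong (swap x y) (star-fixes bs z≢x (z∉ ∘ there)) ⟩
    swap x y z             ≡⟨ swap-fixes z≢x z≢y ⟩
    z                      ∎
    where open ≡-Reasoning

  π-adjacent : ∀ {b c} → Adjacent (a₁ ∷ bs ∷ʳ a₁) b c → π c ≡ b
  π-adjacent here = begin
    π a₂                   ≡⟨ π-split a₂ ⟩
    swap x y (σ (ρ a₂))    ≡⟨ cong (swap x y ∘ σ) ρ-a₂ ⟩
    swap x y (σ a₁)        ≡⟨ cong (swap x y) (star-fixes bs (≢-sym x≢a₁) a₁∉bs) ⟩
    swap x y a₁            ≡⟨ swap-fixes (≢-sym x≢a₁) (≢-sym y≢a₁) ⟩
    a₁                     ∎
    where open ≡-Reasoning
  π-adjacent {b} {c} (there p) with adjacent-∷ʳ⁻ x bs p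
  ... | inj₁ q = begin
    π c                    ≡⟨ π-split c ⟩
    swap x y (σ (ρ c))     ≡⟨ cong (swap x y ∘ σ) (ρ-fixes (∉⇒≢ x∉bs (there c∈rest)) (∉⇒≢ y∉bs (there c∈rest))
                                                          (∉⇒≢ a₁∉bs (there c∈rest)) (∉⇒≢ a₂∉rest c∈rest)) ⟩
    swap x y (σ c)         ≡⟨ cong (swap x y) (star-adjacent bs unique-xbs (there (adjacent-++⁺ q))) ⟩
    swap x y b             ≡⟨ swap-xy-fixes (adjacent-fst∈ q) ⟩
    b                      ∎
    where
    open ≡-Reasoning
    c∈rest : c ∈ rest
    c∈rest = adjacent-snd∈ q
  ... | inj₂ (refl , q) = begin
    π a₁                   ≡⟨ π-split a₁ ⟩
    swap x y (σ (ρ a₁))    ≡⟨ cong (swap x y ∘ σ) ρ-a₁ ⟩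
    swap x y (σ x)         ≡⟨ cong (swap x y) (star-adjacent bs unique-xbs (there q)) ⟩
    swap x y b             ≡⟨ swap-xy-fixes (adjacent-∷ʳ-fst∈ bs q) ⟩
    b                      ∎
    where open ≡-Reasoning

  π∘cycle : ∀ z → π (cycle (a₁ ∷ bs) z) ≡ z
  π∘cycle z with any? (z ≟_) (a₁ ∷ bs)
  ... | yes z∈ = let c , p = cycle-∈-succ bs z∈ in
    trans (cong π (cycleGo-adjacent a₁ a₁ bs unique-a₁bs p)) (π-adjacent p)
  ... | no z∉  = trans (cong π (cycleGo-fixes a₁ a₁ bs z∉)) (π-fixes z∉)

  cycle∘π : ∀ z → cycle (a₁ ∷ bs) (π z) ≡ z
  cycle∘π z with any? (z ≟_) (a₁ ∷ bs)
  ... | yes z∈ = let b , p = cycle-∈-pred z∈ in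
    trans (cong (cycle (a₁ ∷ bs)) (π-adjacent p)) (cycleGo-adjacent a₁ a₁ bs unique-a₁bs p)
  ... | no z∉  = trans (cong (cycle (a₁ ∷ bs)) (π-fixes z∉)) (cycleGo-fixes a₁ a₁ bs z∉)

  nontrivial : All (λ t → proj₁ t ≢ proj₂ t) (inverseFactors x y a₁ a₂ rest)
  nontrivial = x≢y ∷ Allₚ.++⁺ (Allₚ.map⁺ (All.tail (All.tail x≢))) (y≢a₁ ∷ y≢a₂ ∷ x≢a₁ ∷ [])

  distinct : AllPairs (λ s t → ¬ SameTransposition s t) (inverseFactors x y a₁ a₂ rest)
  distinct = Allₚ.++⁺ (Allₚ.map⁺ (All.map ¬same-fst (All.tail y≢))) xy-vs-last
           ∷ AllPairsₚ.++⁺ (AllPairsₚ.map⁺ (AllPairs.map ¬same-fst (AllPairs.tail unique-a₁bs)))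
                           ((¬same-fst a₁≢a₂ ∷ ¬same-≢fst (≢-sym x≢y) y≢a₁ ∷ [])
                             ∷ (¬same-≢fst (≢-sym x≢y) y≢a₁ ∷ []) ∷ [] ∷ [])
                           (Allₚ.map⁺ (All.map xb-vs-last (All.map ≢-sym (AllPairs.head unique-a₁bs))))
    where
    xy-vs-last : All (λ t → ¬ SameTransposition (x , y) t) ((y , a₁) ∷ (y , a₂) ∷ (x , a₁) ∷ [])
    xy-vs-last = ¬same-≢fst x≢y x≢a₁ ∷ ¬same-≢fst x≢y x≢a₂ ∷ ¬same-fst y≢a₁ ∷ []
    xb-vs-last : ∀ {b} → b ≢ a₁ →
                 All (λ t → ¬ SameTransposition (x , b) t) ((y , a₁) ∷ (y , a₂) ∷ (x , a₁) ∷ [])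
    xb-vs-last b≢a₁ = ¬same-≢fst x≢y x≢a₁ ∷ ¬same-≢fst x≢y x≢a₂ ∷ ¬same-fst b≢a₁ ∷ []

inverseFactors-moves-x-or-y : ∀ {x y a₁ a₂ : Fin m} rest →
  All (λ t → (proj₁ t ≡ x ⊎ proj₂ t ≡ x) ⊎ (proj₁ t ≡ y ⊎ proj₂ t ≡ y)) (inverseFactors x y a₁ a₂ rest)
inverseFactors-moves-x-or-y {a₂ = a₂} rest =
  inj₁ (inj₁ refl) ∷ Allₚ.++⁺ (Allₚ.map⁺ (All.universal (λ _ → inj₁ (inj₁ refl)) (a₂ ∷ rest)))
                              (inj₂ (inj₁ refl) ∷ inj₂ (inj₁ refl) ∷ inj₁ (inj₁ refl) ∷ [])

embed-cycleGo : ∀ (h a : Fin n) r z → embed (cycleGo h a r) z ≡ cycleGo (old h) (old a) (map old r) z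
embed-cycleGo h a []      zero          = refl
embed-cycleGo h a []      (suc zero)    = refl
embed-cycleGo h a []      (suc (suc i)) with i ≟ a
... | yes _ = refl
... | no _  = refl
embed-cycleGo h a (b ∷ r) zero          = embed-cycleGo h b r zero
embed-cycleGo h a (b ∷ r) (suc zero)    = embed-cycleGo h b r (suc zero)
embed-cycleGo h a (b ∷ r) (suc (suc i)) with i ≟ a
... | yes _ = refl
... | no _  = embed-cycleGo h b r (suc (suc i))

old-injective : ∀ {i j : Fin n} → old {n} i ≡ old j → i ≡ j
old-injective refl = refl

unique-embed : {l : List (Fin n)} → Unique l → Unique (X ∷ Y ∷ map old l)
unique-embed {l = l} u =
  ((λ ()) ∷ Allₚ.map⁺ (All.universal (λ _ ()) l)) ∷ Allₚ.map⁺ (All.universal (λ _ ()) l)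
    ∷ Unique-map⁺ old-injective u

factors≡inverseFactors : (a₁ a₂ : Fin n) (rest : List (Fin n)) →
  factors a₁ a₂ rest ≡ inverseFactors X Y (old a₁) (old a₂) (map old rest)
factors≡inverseFactors a₁ a₂ rest =
  cong (λ l → (X , Y) ∷ ((X , old a₂) ∷ l) ++ (Y , old a₁) ∷ (Y , old a₂) ∷ (X , old a₁) ∷ [])
       (map-∘ rest)

mainTheorem4 : ∀ (n : ℕ) (a₁ a₂ : Fin n) (rest : List (Fin n))
    → Unique (a₁ ∷ a₂ ∷ rest)
    → ((∀ z → prodSwaps (factors a₁ a₂ rest) (embed (cycle (a₁ ∷ a₂ ∷ rest)) z) ≡ z)
       × (∀ z → embed (cycle (a₁ ∷ a₂ ∷ rest)) (prodSwaps (factors a₁ a₂ rest) z) ≡ z))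
      × All (λ t → ¬ (proj₁ t ≡ proj₂ t)) (factors a₁ a₂ rest)
      × AllPairs (λ s t → ¬ SameTransposition s t) (factors a₁ a₂ rest)
      × All (λ t → (proj₁ t ≡ X ⊎ proj₂ t ≡ X) ⊎ (proj₁ t ≡ Y ⊎ proj₂ t ≡ Y)) (factors a₁ a₂ rest)
mainTheorem4 n a₁ a₂ rest u =
  ( (λ z → trans (factors-π (τ z)) (trans (cong π (τ-embeds z)) (π∘cycle z)))
  , (λ z → trans (cong τ (factors-π z)) (trans (τ-embeds (π z)) (cycle∘π z))) )
  , subst (All _) (sym factors≡) nontrivial
  , subst (AllPairs _) (sym factors≡) distinct
  , subst (All _) (sym factors≡) (inverseFactors-moves-x-or-y (map old rest))
  where
  open InverseFactors (unique-embed u)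
  τ : Fin (suc (suc n)) → Fin (suc (suc n))
  τ = embed (cycle (a₁ ∷ a₂ ∷ rest))
  τ-embeds : ∀ z → τ z ≡ cycle (map old (a₁ ∷ a₂ ∷ rest)) z
  τ-embeds = embed-cycleGo a₁ a₁ (a₂ ∷ rest)
  factors≡ : factors a₁ a₂ rest ≡ inverseFactors X Y (old a₁) (old a₂) (map old rest)
  factors≡ = factors≡inverseFactors a₁ a₂ rest
  factors-π : ∀ z → prodSwaps (factors a₁ a₂ rest) z ≡ π z
  factors-π z = cong (λ l → prodSwaps l z) factors≡
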